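{- Consider inputs $(w,m)$, $w\in\Sigma^*$, $1\le m<\lvert w\rvert$, of the approximate string cover problem (specific version) with respect to the Hamming distance $d$, and the algorithm that outputs the tiling $\mathcal{I}=\{1,2,\dots,\lvert w\rvert-m+1\}$ together with the string $s'=\alpha^m$, where $\alpha\in\arg\max_\beta\mathrm{freq}_w(\beta)$. If $\mathrm{freq}_{\max}(w)=\max_\beta\mathrm{freq}_w(\beta)\in\Omega(\sqrt{\lvert w\rvert})$, then this algorithm is an $\mathcal{O}(\sqrt{\lvert w\rvert})$ approximation, i.e. $\frac{1}{\eta(w,\mathcal{I}(s'))}=\frac{\lvert w\rvert-d(w,w^*)}{\lvert w\rvert-d(w,\mathcal{I}(s'))}\in\mathcal{O}(\sqrt{\lvert w\rvert})$.
   Context: $\mathrm{freq}_w(\beta)$ is the number of occurrences of $\beta$ in $w$. A tiling of size $n$ is a set $\mathcal{I}=\{\mathcal{I}_1<\dots<\mathcal{I}_k\}\subseteq\{1,\dots,n\}$ with $\mathcal{I}_1=1$, norm $\lVert\mathcal{I}\rVert=n+1-\mathcal{I}_k$, and $\mathcal{I}_{i+1}-\mathcal{I}_i\le\lVert\mathcal{I}\rVert$. A word $s$ with $\lvert s\rvert=\lVert\mathcal{I}\rVert$ is valid for $\mathcal{I}$ if copies of $s$ placed starting at the positions $\mathcal{I}_i$ agree on all overlaps, and then $\mathcal{I}(s)$ is the resulting string of length $n$. The approximate string cover problem (specific version): given $w$ and $m<\lvert w\rvert$, find a tiling of size $\lvert w\rvert$ with norm $m$ and a valid $s$ minimizing $d(w,\mathcal{I}(s))$;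 $w^*$ denotes an optimal $\mathcal{I}(s)$. Cover efficiency: $\eta(w,w')=\frac{\lvert w\rvert-d(w,w')}{\lvert w\rvert-d(w,w^*)}$; an algorithm is an $\mathcal{O}(f(\lvert w\rvert))$ approximation iff $1/\eta\in\mathcal{O}(f(\lvert w\rvert))$. -}

module Defs where

open import Data.Nat using (ℕ; zero; suc; _+_; _*_; _∸_; _≤_; _<_)
open import Data.List using (List; []; _∷_; length; last; replicate; applyUpTo)
open import Data.List.Membership.Propositional using (_∈_)
open import Data.List.Relation.Unary.Linked using (Linked)
open import Data.Maybe using (Maybe; just; nothing)
open import Data.Product using (_×_; Σ; ∃)
open import Relation.Binary.PropositionalEquality using (_≡_)
open import Relation.Binary.Definitions using (DecidableEquality)
open import Relation.Nullary using (yes; no)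

-- Strings over an alphabet A are lists; positions are 0-indexed here,
-- tiling positions are 1-indexed as in the paper.

_!!_ : {A : Set} → List A → ℕ → Maybe A
[]       !! _       = nothing
(x ∷ xs) !! zero    = just x
(x ∷ xs) !! (suc i) = xs !! i

freq : {A : Set} → DecidableEquality A → List A → A → ℕ
freq _≟_ []       β = 0
freq _≟_ (x ∷ xs) β with x ≟ β
... | yes _ = suc (freq _≟_ xs β)
... | no  _ = freq _≟_ xs β

ham : {A : Set} → DecidableEquality A → List A → List A → ℕ
ham _≟_ []       ys       = length ys
ham _≟_ (x ∷ xs) []       = length (x ∷ xs)
ham _≟_ (x ∷ xs) (y ∷ ys) with x ≟ y
... | yes _ = ham _≟_ xs ys
... | no  _ = suc (ham _≟_ xs ys)

GapOK : ℕ → ℕ → ℕ → Set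
GapOK m a b = a < b × b ∸ a ≤ m

-- I is a tiling of size n with norm m:
--   I = {I_1 < ... < I_k} ⊆ {1..n}, I_1 = 1, n + 1 - I_k = m,
--   I_{i+1} - I_i ≤ m.
-- (I_k = n+1-m together with strict increase and I_1 = 1 gives I ⊆ {1..n}
--  once m ≥ 1, which the extra conjunct m ≥ 1 ensures.)
record IsTiling (n m : ℕ) (I : List ℕ) : Set where
  field
    norm-pos : 1 ≤ m
    norm-le  : m ≤ n
    starts   : Σ (List ℕ) (λ rest → I ≡ 1 ∷ rest)
    linked   : Linked (GapOK m) I
    lastPos  : last I ≡ just (suc n ∸ m)

-- w' is I(s): w' has length n and, for each tiling position i ∈ I, the copy
-- of s placed starting at (1-indexed) position i agrees with w'.
-- s is valid for I (copies agree on overlaps) iff such a w' exists, and then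
-- w' is the resulting string I(s).
Realizes : {A : Set} → ℕ → List ℕ → List A → List A → Set
Realizes n I s w' =
  length w' ≡ n ×
  (∀ i → i ∈ I → ∀ k → k < length s → w' !! ((i ∸ 1) + k) ≡ s !! k)

Feasible : {A : Set} → List A → ℕ → List ℕ → List A → List A → Set
Feasible w m I s w' =
  IsTiling (length w) m I × length s ≡ m × Realizes (length w) I s w'

Optimal : {A : Set} → DecidableEquality A → List A → ℕ →
          List ℕ → List A → List A → Set
Optimal _≟_ w m I s w* =
  Feasible w m I s w* ×
  (∀ I' s' w' → Feasible w m I' s' w' → ham _≟_ w w* ≤ ham _≟_ w w')

algTiling : ℕ → ℕ → List ℕ
algTiling n m = applyUpTo suc (n ∸ m + 1)

module Submission where

-- The algorithm's tiling {1, …, n-m+1} (n = |w|) places a tile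
-- at every start 0, …, n-m, so every position of a string it realizes is
-- covered by a copy of α^m: the only realization is α^n.  Hence
-- |w| - d(w, I(s')) is exactly freq_w(α), the number of positions where w
-- already carries α.  On the other side |w| - d(w, w*) ≤ |w| trivially, so
-- 1/η ≤ |w| / freq_w(α).  The hypothesis freq_w(α) ≥ (p/q)·√|w|, in the
-- squared form p²|w| ≤ q²·freq_w(α)², gives |w| ≤ q²·freq_w(α)², i.e.
-- |w| / freq_w(α) ≤ q·√|w|; squared: (|w| - d(w,w*))² ≤ q²·|w|·freq_w(α)².
-- So C = q works for every length (N = 0).

open import Defs
open import Data.Nat using (ℕ; zero; suc; _+_; _*_; _∸_; _≤_; _<_)
open import Data.List using (List; length; replicate)
open import Data.Product using (_×_; Σ; ∃)
open import Relation.Binary.Definitions using (DecidableEquality)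

open import Data.Nat using (s≤s; z<s; _≤?_; >-nonZero)
open import Data.Nat.Properties
open import Data.List using ([]; _∷_)
open import Data.List.Properties using (length-replicate)
open import Data.List.Membership.Propositional using (_∈_)
open import Data.List.Membership.Propositional.Properties using (∈-applyUpTo⁺; ∈-applyUpTo⁻)
open import Data.Maybe using (just)
open import Data.Product using (_,_; ∃₂)
open import Relation.Binary.PropositionalEquality
open import Relation.Nullary using (yes; no)

replicate-!! : {A : Set} (a : A) (n j : ℕ) → j < n → replicate n a !! j ≡ just a
replicate-!! a (suc n) zero    _         = refl
replicate-!! a (suc n) (suc j) (s≤s j<n) = replicate-!! a n j j<n

all-positions⇒replicate : {A : Set} (a : A) (xs : List A) →
  (∀ j → j < length xs → xs !! j ≡ just a) → xs ≡ replicate (length xs) a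
all-positions⇒replicate a []       _   = refl
all-positions⇒replicate a (x ∷ xs) all with all 0 z<s
... | refl = cong (x ∷_) (all-positions⇒replicate a xs (λ j j< → all (suc j) (s≤s j<)))

ham-replicate+freq : {A : Set} (_≟_ : DecidableEquality A) (a : A) (w : List A) →
  ham _≟_ w (replicate (length w) a) + freq _≟_ w a ≡ length w
ham-replicate+freq _≟_ a []       = refl
ham-replicate+freq _≟_ a (x ∷ xs) with x ≟ a
... | yes _ = trans (+-suc _ _) (cong suc (ham-replicate+freq _≟_ a xs))
... | no  _ = cong suc (ham-replicate+freq _≟_ a xs)

agreements-with-replicate : {A : Set} (_≟_ : DecidableEquality A) (a : A) (w : List A) →
  length w ∸ ham _≟_ w (replicate (length w) a) ≡ freq _≟_ w a
agreements-with-replicate _≟_ a w = begin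
  length w ∸ h                 ≡⟨ cong (_∸ h) (sym (ham-replicate+freq _≟_ a w)) ⟩
  h + freq _≟_ w a ∸ h         ≡⟨ m+n∸m≡n h (freq _≟_ w a) ⟩
  freq _≟_ w a                 ∎
  where
  open ≡-Reasoning
  h = ham _≟_ w (replicate (length w) a)

algTiling-start⁺ : (n m : ℕ) {t : ℕ} → t ≤ n ∸ m → suc t ∈ algTiling n m
algTiling-start⁺ n m t≤ = ∈-applyUpTo⁺ suc (≤-<-trans t≤ (m<m+n (n ∸ m) z<s))

algTiling-start⁻ : (n m : ℕ) {i : ℕ} → i ∈ algTiling n m → ∃ λ t → t ≤ n ∸ m × i ≡ suc t
algTiling-start⁻ n m i∈ with ∈-applyUpTo⁻ suc i∈
... | t , t< , i≡ = t , m<1+n⇒m≤n (subst (t <_) (+-comm (n ∸ m) 1) t<) , i≡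

tiles-cover : {n m j : ℕ} → m ≤ n → 1 ≤ m → j < n →
  ∃₂ λ t k → t ≤ n ∸ m × k < m × t + k ≡ j
tiles-cover {n} {m} {j} m≤n 1≤m j<n with j ≤? n ∸ m
... | yes j≤ = j , 0 , j≤ , 1≤m , +-identityʳ j
... | no  j≰ = n ∸ m , j ∸ (n ∸ m) , ≤-refl , k<m , t+k≡j
  where
  t+k≡j : (n ∸ m) + (j ∸ (n ∸ m)) ≡ j
  t+k≡j = m+[n∸m]≡n (<⇒≤ (≰⇒> j≰))
  k<m : j ∸ (n ∸ m) < m
  k<m = +-cancelˡ-< (n ∸ m) (j ∸ (n ∸ m)) m
          (subst₂ _<_ (sym t+k≡j) (sym (m∸n+n≡m m≤n)) j<n)

module AlgorithmOutput {A : Set} (α : A) {n m : ℕ} (m≤n : m ≤ n) (1≤m : 1 ≤ m) where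

  replicate-realizes : Realizes n (algTiling n m) (replicate m α) (replicate n α)
  replicate-realizes = length-replicate n , agrees
    where
    agrees : ∀ i → i ∈ algTiling n m → ∀ k → k < length (replicate m α) →
             replicate n α !! ((i ∸ 1) + k) ≡ replicate m α !! k
    agrees i i∈ k k<len with algTiling-start⁻ n m i∈
    ... | t , t≤ , refl = trans (replicate-!! α n (t + k) t+k<n) (sym (replicate-!! α m k k<m))
      where
      k<m : k < m
      k<m = subst (k <_) (length-replicate m) k<len
      t+k<n : t + k < n
      t+k<n = subst (t + k <_) (m∸n+n≡m m≤n) (+-mono-≤-< t≤ k<m)

  -- Since the tiles cover every position, α^n is the only realization.
  realization-unique : (w' : List A) →
    Realizes n (algTiling n m) (replicate m α) w' → w' ≡ replicate n α
  realization-unique w' (len , agrees) =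
    trans (all-positions⇒replicate α w' holds-α) (cong (λ l → replicate l α) len)
    where
    holds-α : ∀ j → j < length w' → w' !! j ≡ just α
    holds-α j j< with tiles-cover m≤n 1≤m (subst (j <_) len j<)
    ... | t , k , t≤ , k<m , refl =
      trans (agrees (suc t) (algTiling-start⁺ n m t≤) k (subst (k <_) (sym (length-replicate m)) k<m))
            (replicate-!! α m k k<m)

-- Arithmetic core of 1/η ∈ O(√n): if p ≥ 1 and p²n ≤ q²f², then every
-- x ≤ n satisfies x² ≤ q²·n·f², since x² ≤ n·n ≤ n·q²f².
square-bound : (p q n f x : ℕ) → 1 ≤ p → p * p * n ≤ q * q * (f * f) → x ≤ n →
  x * x ≤ q * q * n * (f * f)
square-bound p q n f x 1≤p hyp x≤n = begin
  x * x                  ≤⟨ *-mono-≤ x≤n x≤n ⟩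
  n * n                  ≤⟨ *-monoʳ-≤ n n≤q²f² ⟩
  n * (q * q * (f * f))  ≡⟨ sym (*-assoc n (q * q) (f * f)) ⟩
  n * (q * q) * (f * f)  ≡⟨ cong (_* (f * f)) (*-comm n (q * q)) ⟩
  q * q * n * (f * f)    ∎
  where
  open ≤-Reasoning
  n≤q²f² : n ≤ q * q * (f * f)
  n≤q²f² = ≤-trans (m≤n*m n (p * p) {{>-nonZero (*-mono-≤ 1≤p 1≤p)}}) hyp

lemma2 : (A : Set) → (_≟_ : DecidableEquality A) →
    (p q : ℕ) → 1 ≤ p → 1 ≤ q →
    Σ ℕ λ C → Σ ℕ λ N →
    (w : List A) → (m : ℕ) → N ≤ length w → 1 ≤ m → m < length w →
    (α : A) → (∀ β → freq _≟_ w β ≤ freq _≟_ w α) →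
    p * p * length w ≤ q * q * (freq _≟_ w α * freq _≟_ w α) →
    (I* : List ℕ) → (s* w* : List A) → Optimal _≟_ w m I* s* w* →
    (Σ (List A) λ w' → Realizes (length w) (algTiling (length w) m) (replicate m α) w') ×
    ((w' : List A) → Realizes (length w) (algTiling (length w) m) (replicate m α) w' →
    (length w ∸ ham _≟_ w w*) * (length w ∸ ham _≟_ w w*)
    ≤ C * C * length w * ((length w ∸ ham _≟_ w w') * (length w ∸ ham _≟_ w w')))
lemma2 A _≟_ p q 1≤p _ = q , 0 , λ w m _ 1≤m m<n α _ freq-large _ _ w* _ →
  let open AlgorithmOutput α (<⇒≤ m<n) 1≤m in
  (replicate (length w) α , replicate-realizes) ,
  λ w' realizes → subst (λ v → optimal-agreements w w* ≤ q * q * length w * (v * v))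
                        (sym (output-agreements w m α (<⇒≤ m<n) 1≤m w' realizes))
                        (square-bound p q (length w) (freq _≟_ w α) _ 1≤p freq-large
                                      (m∸n≤m (length w) (ham _≟_ w w*)))
  where
  optimal-agreements : List A → List A → ℕ
  optimal-agreements w w* = (length w ∸ ham _≟_ w w*) * (length w ∸ ham _≟_ w w*)

  output-agreements : (w : List A) (m : ℕ) (α : A) → m ≤ length w → 1 ≤ m → (w' : List A) →
    Realizes (length w) (algTiling (length w) m) (replicate m α) w' →
    length w ∸ ham _≟_ w w' ≡ freq _≟_ w α
  output-agreements w m α m≤n 1≤m w' realizes =
    trans (cong (λ u → length w ∸ ham _≟_ w u) (AlgorithmOutput.realization-unique α m≤n 1≤m w' realizes))
          (agreements-with-replicate _≟_ α w)
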